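{- For cycle factorizations $f,f'$ in $S_n$, $\mathcal M(f)=\mathcal M(f')$ if and only if $f$ and $f'$ are equivalent (i.e. one can be obtained from the other by repeatedly interchanging adjacent disjoint factors).
   Context: Permutations are multiplied right to left. A cycle factorization is a tuple $f=(\sigma_1,\ldots,\sigma_r)$ of nontrivial cycles in $S_n$. The labelled alternating map $\mathcal M(f)$ is defined as follows. Its vertices are: for each symbol $i\in\{1,\ldots,n\}$ a tail leaf and a head leaf, both labelled $i$, and for each factor $\sigma_j$ one unlabelled internal vertex $v_j$. For each symbol $i$, let $j_1>j_2>\cdots>j_t$ be the indices of the factors that move $i$; add the directed path tail$_i\to v_{j_1}\to v_{j_2}\to\cdots\to v_{j_t}\to$ head$_i$ (just tail$_i\to$head$_i$ if $t=0$), all of whose edges are labelled $i$. The embedding in an orientable surface is specified by the rotation at each internal vertex: if $\sigma_j=(i_1\,i_2\,\cdots\,i_k)$, then the $2k$ edges at $v_j$ in counterclockwise order are the out-edge labelled $i_1$, the in-edge labelled $i_1$, the out-edge labelled $i_2$, the in-edge labelled $i_2$, ..., the out-edge labelled $i_k$, the in-edge labelled $i_k$. Equality $\mathcal M(f)=\mathcal M(f')$ means isomorphism of embedded digraphs preserving edge directions, all labels, and rotation systems. -}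

module Defs where

open import Data.Nat using (ℕ; zero; suc)
open import Data.Fin using (Fin; zero; suc; inject₁; _≟_)
open import Data.List using (List; []; _∷_; _++_; length; lookup; reverse; filter; allFin)
open import Data.Vec using (Vec; []; _∷_) renaming (lookup to vlookup)
open import Data.Maybe using (Maybe; just; nothing)
open import Data.Product using (Σ; ∃; ∃-syntax; _×_; _,_)
open import Data.Sum using (_⊎_)
open import Relation.Nullary using (¬_; ¬?)
open import Relation.Binary.PropositionalEquality using (_≡_; _≢_)
open import Relation.Binary.Construct.Closure.ReflexiveTransitive using (Star)
open import Data.List.Relation.Binary.Pointwise using (Pointwise)
open import Function.Definitions using (Injective)
open import Function.Bundles using (_↔_; _⇔_; Inverse)

iter : ∀ {n} → (Fin n → Fin n) → Fin n → ℕ → Fin n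
iter g x zero    = x
iter g x (suc k) = g (iter g x k)

-- A nontrivial cycle in S_n: an injective (hence bijective) self-map of
-- Fin n that moves some point `base`, and every moved point lies in the
-- orbit of `base`.
record Cycle (n : ℕ) : Set where
  field
    fun   : Fin n → Fin n
    inj   : Injective _≡_ _≡_ fun
    base  : Fin n
    moved : fun base ≢ base
    conn  : ∀ i → fun i ≢ i → ∃[ k ] (iter fun base k ≡ i)
open Cycle public

Factorization : ℕ → Set
Factorization n = List (Cycle n)

_≈ᶜ_ : ∀ {n} → Cycle n → Cycle n → Set
σ ≈ᶜ τ = ∀ i → fun σ i ≡ fun τ i

Disjoint : ∀ {n} → Cycle n → Cycle n → Set
Disjoint σ τ = ∀ i → fun σ i ≡ i ⊎ fun τ i ≡ i

Swap : ∀ {n} → Factorization n → Factorization n → Set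
Swap {n} f g = Σ (Factorization n) λ a → Σ (Factorization n) λ b →
  Σ (Cycle n) λ σ → Σ (Cycle n) λ τ →
  Disjoint σ τ × f ≡ a ++ σ ∷ τ ∷ b × g ≡ a ++ τ ∷ σ ∷ b

Equivalent : ∀ {n} → Factorization n → Factorization n → Set
Equivalent f f' = ∃[ g ] (Star Swap f g × Pointwise _≈ᶜ_ g f')

-- Labelled embedded digraphs.  Darts are edge-ends; the rotation system
-- is given by the counterclockwise-successor relation on darts.

data End : Set where
  out inn : End

record LMap (n : ℕ) : Set₁ where
  field
    V E  : Set
    src tgt : E → V
    vlab : V → Maybe (Fin n)
    elab : E → Fin n
    Succ : E × End → E × End → Set

  dartVertex : E × End → V
  dartVertex (e , out) = src e
  dartVertex (e , inn) = tgt e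

record _≅_ {n : ℕ} (M M' : LMap n) : Set where
  private
    module M  = LMap M
    module M' = LMap M'
  field
    φV : M.V ↔ M'.V
    φE : M.E ↔ M'.E
  φv = Inverse.to φV
  φe = Inverse.to φE
  φd : M.E × End → M'.E × End
  φd (e , x) = (φe e , x)
  field
    src-pres  : ∀ e → M'.src (φe e) ≡ φv (M.src e)
    tgt-pres  : ∀ e → M'.tgt (φe e) ≡ φv (M.tgt e)
    vlab-pres : ∀ v → M'.vlab (φv v) ≡ M.vlab v
    elab-pres : ∀ e → M'.elab (φe e) ≡ M.elab e
    rot-pres  : ∀ d d' → M.Succ d d' ⇔ M'.Succ (φd d) (φd d')

data Vtx (n r : ℕ) : Set where
  tail head : Fin n → Vtx n r
  int       : Fin r → Vtx n r

module _ {n : ℕ} (f : Factorization n) where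
  private
    r = length f

  σ : Fin r → Cycle n
  σ j = lookup f j

  -- indices j₁ > j₂ > ⋯ > j_t of the factors moving symbol i
  movers : Fin n → List (Fin r)
  movers i = filter (λ j → ¬? (fun (σ j) i ≟ i)) (reverse (allFin r))

  pathFrom : Fin n → (l : List (Fin r)) → Vec (Vtx n r) (suc (length l))
  pathFrom i []      = head i ∷ []
  pathFrom i (j ∷ l) = int j ∷ pathFrom i l

  path : (i : Fin n) → Vec (Vtx n r) (suc (suc (length (movers i))))
  path i = tail i ∷ pathFrom i (movers i)

  MEdge : Set
  MEdge = Σ (Fin n) λ i → Fin (suc (length (movers i)))

  Msrc Mtgt : MEdge → Vtx n r
  Msrc (i , k) = vlookup (path i) (inject₁ k)
  Mtgt (i , k) = vlookup (path i) (suc k)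

  Mvlab : Vtx n r → Maybe (Fin n)
  Mvlab (tail i) = just i
  Mvlab (head i) = just i
  Mvlab (int _)  = nothing

  Melab : MEdge → Fin n
  Melab (i , _) = i

  Mdv : MEdge × End → Vtx n r
  Mdv (e , out) = Msrc e
  Mdv (e , inn) = Mtgt e

  -- At v_j with σ_j = (i₁ i₂ ⋯ i_k), the ccw order is
  -- out i₁, in i₁, out i₂, in i₂, …, i.e. the ccw successor of the
  -- out-edge labelled i is the in-edge labelled i, and the successor of
  -- the in-edge labelled i is the out-edge labelled σ_j(i).
  MSucc : MEdge × End → MEdge × End → Set
  MSucc (e , x) (e' , x') = Σ (Fin r) λ j →
    Mdv (e , x) ≡ int j × Mdv (e' , x') ≡ int j ×
    ((x ≡ out × x' ≡ inn × Melab e' ≡ Melab e)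
     ⊎ (x ≡ inn × x' ≡ out × Melab e' ≡ fun (σ j) (Melab e)))

  𝓜 : LMap n
  𝓜 = record { V = Vtx n r ; E = MEdge ; src = Msrc ; tgt = Mtgt
             ; vlab = Mvlab ; elab = Melab ; Succ = MSucc }

-- Both relations are captured by a reindexing: a bijection π between the factors of f
-- and of f' that matches equal factors and preserves, for every symbol i, the order of
-- the factors moving i.  An interchange of adjacent disjoint factors is a reindexing,
-- and reindexings compose.  Conversely, the factor of f sent to the front of f' is
-- disjoint from every factor before it in f, so swaps bring it to the front, and the
-- remaining factors are again related by a reindexing.
--
-- A reindexing carries the sequence of factors moving i in f onto that of f', hence the
-- path of symbol i in M(f) onto the one in M(f'), and it respects rotations because
-- matched factors are equal.  Conversely an isomorphism of maps sends unlabelled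
-- vertices to unlabelled vertices, which defines π.  It matches factors because the
-- rotation at v_j turns the in-edge labelled i into the out-edge labelled σ_j(i), and it
-- preserves the order along the path of i because every edge strictly decreases the
-- rank  tail > v_{r-1} > ⋯ > v_0 > head.

module Submission where

open import Defs
open import Data.Nat as ℕ using (ℕ; zero; suc; pred; z≤n; s≤s)
import Data.Nat.Properties as ℕP
open import Data.Fin using (Fin; zero; suc; toℕ; inject₁; cast; _<_; _>_; _≟_)
import Data.Fin.Properties as Fin
open import Data.Vec using () renaming (lookup to vlookup)
open import Data.Maybe using (nothing)
open import Data.Product as Product using (Σ; _×_; _,_; proj₁; proj₂)
open import Data.Sum as Sum using (inj₁; inj₂)
open import Data.Empty using (⊥-elim)
open import Data.Empty.Irrelevant using () renaming (⊥-elim to ⊥-elim-irr)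
open import Data.List using (List; []; _∷_; length; lookup; removeAt; map; reverse; allFin)
open import Data.List.Properties using (unfold-reverse; length-map)
open import Data.List.Relation.Unary.All as All using (All; []; _∷_)
import Data.List.Relation.Unary.All.Properties as All
open import Data.List.Relation.Unary.Any using (here; there)
import Data.List.Relation.Unary.Any.Properties as Any
open import Data.List.Relation.Unary.AllPairs using (AllPairs; []; _∷_)
import Data.List.Relation.Unary.AllPairs.Properties as AllPairs
open import Data.List.Relation.Binary.Pointwise using (Pointwise; []; _∷_)
open import Data.List.Relation.Binary.Subset.Propositional using (_⊆_)
open import Data.List.Membership.Propositional using (_∈_)
open import Data.List.Membership.Propositional.Properties using (∈-map⁺; ∈-map⁻; ∈-filter⁺; ∈-filter⁻; ∈-allFin)
open import Relation.Nullary using (¬?; yes; no)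
open import Relation.Binary.Definitions using (Asymmetric; Transitive)
open import Relation.Binary.PropositionalEquality
open import Relation.Binary.Construct.Closure.ReflexiveTransitive using (Star; ε; _◅_; _◅◅_; gmap)
open import Function.Base using (flip; id; _∘_)
open import Function.Bundles using (_↔_; _⇔_; Inverse; Equivalence; mk⇔; mk↔ₛ′)

module _ {A : Set} where

  punchInAt : (xs : List A) (j : Fin (length xs)) → Fin (length (removeAt xs j)) → Fin (length xs)
  punchInAt (x ∷ xs) zero    k       = suc k
  punchInAt (x ∷ xs) (suc j) zero    = zero
  punchInAt (x ∷ xs) (suc j) (suc k) = suc (punchInAt xs j k)

  punchOutAt : (xs : List A) (j x : Fin (length xs)) → .(j ≢ x) → Fin (length (removeAt xs j))
  punchOutAt (y ∷ xs) zero    zero    j≢x = ⊥-elim-irr (j≢x refl)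
  punchOutAt (y ∷ xs) zero    (suc x) _   = x
  punchOutAt (y ∷ xs) (suc j) zero    _   = zero
  punchOutAt (y ∷ xs) (suc j) (suc x) j≢x = suc (punchOutAt xs j x (j≢x ∘ cong suc))

  lookup-removeAt : ∀ xs j k → lookup (removeAt xs j) k ≡ lookup xs (punchInAt xs j k)
  lookup-removeAt (x ∷ xs) zero    k       = refl
  lookup-removeAt (x ∷ xs) (suc j) zero    = refl
  lookup-removeAt (x ∷ xs) (suc j) (suc k) = lookup-removeAt xs j k

  punchInAt-≢ : ∀ xs j k → j ≢ punchInAt xs j k
  punchInAt-≢ (x ∷ xs) (suc j) (suc k) j≡ = punchInAt-≢ xs j k (Fin.suc-injective j≡)

  punchInAt-mono : ∀ xs j {k k'} → k < k' → punchInAt xs j k < punchInAt xs j k'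
  punchInAt-mono (x ∷ xs) zero    k<k'                        = s≤s k<k'
  punchInAt-mono (x ∷ xs) (suc j) {zero}  {suc _} _          = s≤s z≤n
  punchInAt-mono (x ∷ xs) (suc j) {suc _} {suc _} (s≤s k<k') = s≤s (punchInAt-mono xs j k<k')

  punchInAt-punchOutAt : ∀ xs j x .(j≢x : j ≢ x) → punchInAt xs j (punchOutAt xs j x j≢x) ≡ x
  punchInAt-punchOutAt (y ∷ xs) zero    zero    j≢x = ⊥-elim-irr (j≢x refl)
  punchInAt-punchOutAt (y ∷ xs) zero    (suc x) _   = refl
  punchInAt-punchOutAt (y ∷ xs) (suc j) zero    _   = refl
  punchInAt-punchOutAt (y ∷ xs) (suc j) (suc x) j≢x =
    cong suc (punchInAt-punchOutAt xs j x (j≢x ∘ cong suc))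

  punchOutAt-punchInAt : ∀ xs j {x k} .(j≢x : j ≢ x) → x ≡ punchInAt xs j k → punchOutAt xs j x j≢x ≡ k
  punchOutAt-punchInAt (y ∷ xs) zero    {k = k}     _   refl = refl
  punchOutAt-punchInAt (y ∷ xs) (suc j) {k = zero}  _   refl = refl
  punchOutAt-punchInAt (y ∷ xs) (suc j) {k = suc k} j≢x refl =
    cong suc (punchOutAt-punchInAt xs j (j≢x ∘ cong suc) refl)

  punchOutAt-mono : ∀ xs j {x x'} .(j≢x : j ≢ x) .(j≢x' : j ≢ x') → x < x' →
                    punchOutAt xs j x j≢x < punchOutAt xs j x' j≢x'
  punchOutAt-mono (y ∷ xs) zero    {zero}  j≢x _    _          = ⊥-elim-irr (j≢x refl)
  punchOutAt-mono (y ∷ xs) zero    {suc _} {suc _} _ _ (s≤s x<x') = x<x'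
  punchOutAt-mono (y ∷ xs) (suc j) {zero}  {suc _} _ _ _          = s≤s z≤n
  punchOutAt-mono (y ∷ xs) (suc j) {suc _} {suc _} j≢x j≢x' (s≤s x<x') =
    s≤s (punchOutAt-mono xs j (j≢x ∘ cong suc) (j≢x' ∘ cong suc) x<x')

module _ {A : Set} {R : A → A → Set} where

  AllPairs-reverse⁺ : ∀ {xs} → AllPairs R xs → AllPairs (flip R) (reverse xs)
  AllPairs-reverse⁺ []                    = []
  AllPairs-reverse⁺ {x ∷ xs} (Rx ∷ Rxs) rewrite unfold-reverse x xs =
    AllPairs.++⁺ (AllPairs-reverse⁺ Rxs) ([] ∷ [])
      (All.tabulate (λ y∈ → All.lookup Rx (Any.reverse⁻ y∈) ∷ []))

  AllPairs-map⁺-∈ : ∀ {B : Set} {S : B → B → Set} {h : A → B} {xs} →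
                    (∀ {x y} → x ∈ xs → y ∈ xs → R x y → S (h x) (h y)) →
                    AllPairs R xs → AllPairs S (map h xs)
  AllPairs-map⁺-∈ t []         = []
  AllPairs-map⁺-∈ t (Rx ∷ Rxs) =
    All.map⁺ (All.tabulate (λ y∈ → t (here refl) (there y∈) (All.lookup Rx y∈)))
    ∷ AllPairs-map⁺-∈ (λ x∈ y∈ → t (there x∈) (there y∈)) Rxs

  ⊆-drop-∷ : Asymmetric R → ∀ {z zs zs'} → All (R z) zs → z ∷ zs ⊆ z ∷ zs' → zs ⊆ zs'
  ⊆-drop-∷ asym Rz sub w∈ with sub (there w∈)
  ... | here refl = ⊥-elim (asym (All.lookup Rz w∈) (All.lookup Rz w∈))
  ... | there w∈' = w∈'

  AllPairs-unique : Asymmetric R → ∀ {xs ys} → AllPairs R xs → AllPairs R ys → xs ⊆ ys → ys ⊆ xs → xs ≡ ys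
  AllPairs-unique asym []          []          _     _     = refl
  AllPairs-unique asym []          (_ ∷ _)     _     ys⊆xs with () ← ys⊆xs (here refl)
  AllPairs-unique asym (_ ∷ _)     []          xs⊆ys _     with () ← xs⊆ys (here refl)
  AllPairs-unique asym {x ∷ xs} {y ∷ ys} (Rx ∷ Rxs) (Ry ∷ Rys) xs⊆ys ys⊆xs
    with xs⊆ys (here refl) | ys⊆xs (here refl)
  ... | here refl  | _          =
    cong (x ∷_) (AllPairs-unique asym Rxs Rys (⊆-drop-∷ asym Rx xs⊆ys) (⊆-drop-∷ asym Ry ys⊆xs))
  ... | there _    | here refl  =
    cong (x ∷_) (AllPairs-unique asym Rxs Rys (⊆-drop-∷ asym Rx xs⊆ys) (⊆-drop-∷ asym Ry ys⊆xs))
  ... | there x∈ys | there y∈xs = ⊥-elim (asym (All.lookup Rx y∈xs) (All.lookup Ry x∈ys))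

Moves : ∀ {n} → Cycle n → Fin n → Set
Moves c i = fun c i ≢ i

Moves-resp-≈ᶜ : ∀ {n} {c d : Cycle n} {i} → c ≈ᶜ d → Moves d i → Moves c i
Moves-resp-≈ᶜ {i = i} c≈d d-moves c-fixes = d-moves (trans (sym (c≈d i)) c-fixes)

module _ {n : ℕ} (f : Factorization n) (i : Fin n) where

  movers-descending : AllPairs _>_ (movers f i)
  movers-descending = AllPairs.filter⁺ _ (AllPairs-reverse⁺ (AllPairs.tabulate⁺-< id))

  ∈-movers⁺ : ∀ {j} → Moves (lookup f j) i → j ∈ movers f i
  ∈-movers⁺ {j} = ∈-filter⁺ (λ j → ¬? (fun (σ f j) i ≟ i)) (Any.reverse⁺ (∈-allFin j))

  ∈-movers⁻ : ∀ {j} → j ∈ movers f i → Moves (lookup f j) i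
  ∈-movers⁻ j∈ =
    proj₂ (∈-filter⁻ (λ j → ¬? (fun (σ f j) i ≟ i)) {xs = reverse (allFin (length f))} j∈)

rank : ∀ {n r} → Vtx n r → ℕ
rank {r = r} (tail _) = suc r
rank         (head _) = zero
rank         (int j)  = suc (toℕ j)

module _ {n : ℕ} (h : Factorization n) (i : Fin n) where

  pathFrom-chain : {R : Vtx n (length h) → Vtx n (length h) → Set} → Transitive R →
                   ∀ {l} → AllPairs _>_ l →
                   (∀ k → R (vlookup (pathFrom h i l) (inject₁ k)) (vlookup (pathFrom h i l) (suc k))) →
                   ∀ {x y} → x ∈ l → y ∈ l → y < x → R (int x) (int y)
  pathFrom-chain R-trans (_ ∷ _) step (here refl) (here refl) y<x = ⊥-elim (Fin.<-irrefl refl y<x)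
  pathFrom-chain R-trans (z>l ∷ _) step (there x∈) (here refl) y<x = ⊥-elim (Fin.<-asym y<x (All.lookup z>l x∈))
  pathFrom-chain {R} R-trans (_ ∷ l↓) step (there x∈) (there y∈) y<x =
    pathFrom-chain {R} R-trans l↓ (λ k → step (suc k)) x∈ y∈ y<x
  pathFrom-chain R-trans {_ ∷ _ ∷ _} _ step (here refl) (there (here refl)) _ = step zero
  pathFrom-chain {R} R-trans {_ ∷ _ ∷ _} (_ ∷ w>l ∷ l↓) step (here refl) (there (there y∈)) _ =
    R-trans (step zero)
      (pathFrom-chain {R} R-trans (w>l ∷ l↓) (λ k → step (suc k)) (here refl) (there y∈) (All.lookup w>l y∈))

  pathFrom-rank : ∀ {l} → AllPairs _>_ l → ∀ k →
                  rank (vlookup (pathFrom h i l) (suc k)) ℕ.< rank (vlookup (pathFrom h i l) (inject₁ k))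
  pathFrom-rank {_ ∷ []}    _                 zero    = s≤s z≤n
  pathFrom-rank {_ ∷ _ ∷ _} ((x>y ∷ _) ∷ _)   zero    = s≤s x>y
  pathFrom-rank {_ ∷ _ ∷ _} (_ ∷ l↓)          (suc k) = pathFrom-rank l↓ k

  pathFrom-∈ : ∀ {l j} → j ∈ l → Σ (Fin (length l)) λ a → vlookup (pathFrom h i l) (inject₁ a) ≡ int j
  pathFrom-∈ (here refl) = zero , refl
  pathFrom-∈ (there j∈)  = Product.map suc id (pathFrom-∈ j∈)

  ∈-pathFrom : ∀ {l j} (k : Fin (suc (length l))) → vlookup (pathFrom h i l) k ≡ int j → j ∈ l
  ∈-pathFrom {_ ∷ _} zero    refl = here refl
  ∈-pathFrom {_ ∷ _} (suc k) at-j = there (∈-pathFrom k at-j)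

module _ {n : ℕ} (h : Factorization n) where

  pathFrom-head-rank : ∀ i l → rank (vlookup (pathFrom h i l) zero) ℕ.< suc (length h)
  pathFrom-head-rank i []      = s≤s z≤n
  pathFrom-head-rank i (x ∷ _) = s≤s (Fin.toℕ<n x)

  rank-decreases : ∀ e → rank (Mtgt h e) ℕ.< rank (Msrc h e)
  rank-decreases (i , zero)  = pathFrom-head-rank i (movers h i)
  rank-decreases (i , suc k) = pathFrom-rank h i (movers-descending h i) k

  InEdge OutEdge : Fin (length h) → Fin n → Set
  InEdge  j i = Σ (MEdge h) λ e → Melab h e ≡ i × Mtgt h e ≡ int j
  OutEdge j i = Σ (MEdge h) λ e → Melab h e ≡ i × Msrc h e ≡ int j

  Moves⇒InEdge : ∀ {j i} → Moves (lookup h j) i → InEdge j i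
  Moves⇒InEdge {i = i} moves with a , at-j ← pathFrom-∈ h i (∈-movers⁺ h i moves) =
    (i , inject₁ a) , refl , at-j

  Moves⇒OutEdge : ∀ {j i} → Moves (lookup h j) i → OutEdge j i
  Moves⇒OutEdge {i = i} moves with a , at-j ← pathFrom-∈ h i (∈-movers⁺ h i moves) =
    (i , suc a) , refl , at-j

  InEdge⇒Moves : ∀ {j i} → InEdge j i → Moves (lookup h j) i
  InEdge⇒Moves ((i , k) , refl , at-j) = ∈-movers⁻ h i (∈-pathFrom h i k at-j)

  unlabelled⇒int : (v : Vtx n (length h)) → Mvlab h v ≡ nothing → Σ (Fin (length h)) λ j → v ≡ int j
  unlabelled⇒int (tail _) ()
  unlabelled⇒int (head _) ()
  unlabelled⇒int (int j)  _ = j , refl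

int-injective : ∀ {n r} {j k : Fin r} → Vtx.int {n} j ≡ int k → j ≡ k
int-injective refl = refl

-- Reindexings

record Reindexing {n : ℕ} (f g : Factorization n) : Set where
  field
    to        : Fin (length f) → Fin (length g)
    from      : Fin (length g) → Fin (length f)
    to-from   : ∀ k → to (from k) ≡ k
    from-to   : ∀ j → from (to j) ≡ j
    lookup-to : ∀ j → lookup g (to j) ≈ᶜ lookup f j
    to-mono   : ∀ {i j j'} → j < j' → Moves (lookup f j) i → Moves (lookup f j') i → to j < to j'

  lookup-from : ∀ k → lookup g k ≈ᶜ lookup f (from k)
  lookup-from k i = trans (cong (λ k′ → fun (lookup g k′) i) (sym (to-from k))) (lookup-to (from k) i)

  Moves-to : ∀ {i j} → Moves (lookup f j) i → Moves (lookup g (to j)) i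
  Moves-to {j = j} = Moves-resp-≈ᶜ {c = lookup g (to j)} {lookup f j} (lookup-to j)

  Moves-from : ∀ {i k} → Moves (lookup g k) i → Moves (lookup f (from k)) i
  Moves-from {k = k} = Moves-resp-≈ᶜ {c = lookup f (from k)} {lookup g k} (λ i → sym (lookup-from k i))

open Reindexing

module _ {n : ℕ} where

  Reindexing-refl : (f : Factorization n) → Reindexing f f
  Reindexing-refl f = record
    { to = id ; from = id ; to-from = λ _ → refl ; from-to = λ _ → refl
    ; lookup-to = λ _ _ → refl ; to-mono = λ j<j' _ _ → j<j' }

  Reindexing-trans : {f g h : Factorization n} → Reindexing f g → Reindexing g h → Reindexing f h
  Reindexing-trans G H = record
    { to        = λ j → to H (to G j)
    ; from      = λ k → from G (from H k)
    ; to-from   = λ k → trans (cong (to H) (to-from G (from H k))) (to-from H k)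
    ; from-to   = λ j → trans (cong (from G) (from-to H (to G j))) (from-to G j)
    ; lookup-to = λ j i → trans (lookup-to H (to G j) i) (lookup-to G j i)
    ; to-mono   = λ j<j' m m' → to-mono H (to-mono G j<j' m m') (Moves-to G m) (Moves-to G m')
    }

  Reindexing-∷ : {f g : Factorization n} {c d : Cycle n} → d ≈ᶜ c → Reindexing f g →
                 Reindexing (c ∷ f) (d ∷ g)
  Reindexing-∷ {f} {g} {c} {d} d≈c G = record
    { to = to′ ; from = from′ ; to-from = to-from′ ; from-to = from-to′
    ; lookup-to = lookup-to′ ; to-mono = to-mono′ }
    where
    to′ : Fin (length (c ∷ f)) → Fin (length (d ∷ g))
    to′ zero    = zero
    to′ (suc j) = suc (to G j)
    from′ : Fin (length (d ∷ g)) → Fin (length (c ∷ f))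
    from′ zero    = zero
    from′ (suc k) = suc (from G k)
    to-from′ : ∀ k → to′ (from′ k) ≡ k
    to-from′ zero    = refl
    to-from′ (suc k) = cong suc (to-from G k)
    from-to′ : ∀ j → from′ (to′ j) ≡ j
    from-to′ zero    = refl
    from-to′ (suc j) = cong suc (from-to G j)
    lookup-to′ : ∀ j → lookup (d ∷ g) (to′ j) ≈ᶜ lookup (c ∷ f) j
    lookup-to′ zero    = d≈c
    lookup-to′ (suc j) = lookup-to G j
    to-mono′ : ∀ {i j j'} → j < j' → Moves (lookup (c ∷ f) j) i → Moves (lookup (c ∷ f) j') i →
               to′ j < to′ j'
    to-mono′ {j = zero}  {suc _} _          _ _  = s≤s z≤n
    to-mono′ {j = suc _} {suc _} (s≤s j<j') m m' = s≤s (to-mono G j<j' m m')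

  Reindexing-swap-head : (c d : Cycle n) (f : Factorization n) → Disjoint c d →
                         Reindexing (c ∷ d ∷ f) (d ∷ c ∷ f)
  Reindexing-swap-head c d f c⊥d = record
    { to = swap ; from = swap ; to-from = swap-involutive ; from-to = swap-involutive
    ; lookup-to = lookup-swap ; to-mono = swap-mono }
    where
    swap : ∀ {m} → Fin (suc (suc m)) → Fin (suc (suc m))
    swap zero          = suc zero
    swap (suc zero)    = zero
    swap (suc (suc j)) = suc (suc j)
    swap-involutive : ∀ {m} (j : Fin (suc (suc m))) → swap (swap j) ≡ j
    swap-involutive zero          = refl
    swap-involutive (suc zero)    = refl
    swap-involutive (suc (suc j)) = refl
    lookup-swap : ∀ j → lookup (d ∷ c ∷ f) (swap j) ≈ᶜ lookup (c ∷ d ∷ f) j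
    lookup-swap zero          _ = refl
    lookup-swap (suc zero)    _ = refl
    lookup-swap (suc (suc j)) _ = refl
    swap-mono : ∀ {i j j'} → j < j' → Moves (lookup (c ∷ d ∷ f) j) i → Moves (lookup (c ∷ d ∷ f) j') i →
                swap j < swap j'
    swap-mono {i} {zero} {suc zero} _ m m' with c⊥d i
    ... | inj₁ c-fixes = ⊥-elim (m c-fixes)
    ... | inj₂ d-fixes = ⊥-elim (m' d-fixes)
    swap-mono {j = zero}        {suc (suc _)} _        _ _ = s≤s (s≤s z≤n)
    swap-mono {j = suc zero}    {suc (suc _)} _        _ _ = s≤s z≤n
    swap-mono {j = suc (suc _)} {suc (suc _)} j<j'     _ _ = j<j'
    swap-mono {j = suc zero}    {suc zero}    (s≤s ()) _ _
    swap-mono {j = suc (suc _)} {suc zero}    (s≤s ()) _ _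

  Reindexing-swap : {f g : Factorization n} → Swap f g → Reindexing f g
  Reindexing-swap ([] , b , c , d , c⊥d , refl , refl) = Reindexing-swap-head c d b c⊥d
  Reindexing-swap (e ∷ a , b , c , d , c⊥d , refl , refl) =
    Reindexing-∷ (λ _ → refl) (Reindexing-swap (a , b , c , d , c⊥d , refl , refl))

  Star⇒Reindexing : {f g : Factorization n} → Star Swap f g → Reindexing f g
  Star⇒Reindexing ε        = Reindexing-refl _
  Star⇒Reindexing (s ◅ ss) = Reindexing-trans (Reindexing-swap s) (Star⇒Reindexing ss)

  Pointwise⇒Reindexing : {f g : Factorization n} → Pointwise _≈ᶜ_ f g → Reindexing f g
  Pointwise⇒Reindexing []         = Reindexing-refl []
  Pointwise⇒Reindexing (c≈d ∷ pw) = Reindexing-∷ (λ i → sym (c≈d i)) (Pointwise⇒Reindexing pw)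

  Equivalent⇒Reindexing : {f g : Factorization n} → Equivalent f g → Reindexing f g
  Equivalent⇒Reindexing (_ , swaps , pw) = Reindexing-trans (Star⇒Reindexing swaps) (Pointwise⇒Reindexing pw)

-- A reindexing is a sequence of interchanges

module _ {n : ℕ} where

  Reindexing-removeAt : {f g : Factorization n} (G : Reindexing f g) (j : Fin (length f)) →
                        Reindexing (removeAt f j) (removeAt g (to G j))
  Reindexing-removeAt {f} {g} G j = record
    { to = to′ ; from = from′ ; to-from = to-from′ ; from-to = from-to′
    ; lookup-to = lookup-to′ ; to-mono = to-mono′ }
    where
    to-≢ : ∀ k → to G j ≢ to G (punchInAt f j k)
    to-≢ k e = punchInAt-≢ f j k (trans (sym (from-to G j)) (trans (cong (from G) e) (from-to G _)))
    from-≢ : ∀ k → j ≢ from G (punchInAt g (to G j) k)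
    from-≢ k e = punchInAt-≢ g (to G j) k (trans (cong (to G) e) (to-from G _))
    to′ : Fin (length (removeAt f j)) → Fin (length (removeAt g (to G j)))
    to′ k = punchOutAt g (to G j) (to G (punchInAt f j k)) (to-≢ k)
    from′ : Fin (length (removeAt g (to G j))) → Fin (length (removeAt f j))
    from′ k = punchOutAt f j (from G (punchInAt g (to G j) k)) (from-≢ k)
    punchInAt-to′ : ∀ k → punchInAt g (to G j) (to′ k) ≡ to G (punchInAt f j k)
    punchInAt-to′ k = punchInAt-punchOutAt g (to G j) _ (to-≢ k)
    punchInAt-from′ : ∀ k → punchInAt f j (from′ k) ≡ from G (punchInAt g (to G j) k)
    punchInAt-from′ k = punchInAt-punchOutAt f j _ (from-≢ k)
    to-from′ : ∀ k → to′ (from′ k) ≡ k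
    to-from′ k = punchOutAt-punchInAt g (to G j) (to-≢ (from′ k))
      (trans (cong (to G) (punchInAt-from′ k)) (to-from G _))
    from-to′ : ∀ k → from′ (to′ k) ≡ k
    from-to′ k = punchOutAt-punchInAt f j (from-≢ (to′ k))
      (trans (cong (from G) (punchInAt-to′ k)) (from-to G _))
    lookup-to′ : ∀ k → lookup (removeAt g (to G j)) (to′ k) ≈ᶜ lookup (removeAt f j) k
    lookup-to′ k i = begin
      fun (lookup (removeAt g (to G j)) (to′ k)) i    ≡⟨ cong (λ c → fun c i) (lookup-removeAt g (to G j) (to′ k)) ⟩
      fun (lookup g (punchInAt g (to G j) (to′ k))) i ≡⟨ cong (λ x → fun (lookup g x) i) (punchInAt-to′ k) ⟩
      fun (lookup g (to G (punchInAt f j k))) i       ≡⟨ lookup-to G (punchInAt f j k) i ⟩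
      fun (lookup f (punchInAt f j k)) i              ≡⟨ cong (λ c → fun c i) (sym (lookup-removeAt f j k)) ⟩
      fun (lookup (removeAt f j) k) i                 ∎
      where open ≡-Reasoning
    Moves-punchInAt : ∀ {i k} → Moves (lookup (removeAt f j) k) i → Moves (lookup f (punchInAt f j k)) i
    Moves-punchInAt {i} {k} = subst (λ c → Moves c i) (lookup-removeAt f j k)
    to-mono′ : ∀ {i k k'} → k < k' → Moves (lookup (removeAt f j) k) i → Moves (lookup (removeAt f j) k') i →
               to′ k < to′ k'
    to-mono′ k<k' m m' = punchOutAt-mono g (to G j) (to-≢ _) (to-≢ _)
      (to-mono G (punchInAt-mono f j k<k') (Moves-punchInAt m) (Moves-punchInAt m'))

  Swap-∷ : (c : Cycle n) {f g : Factorization n} → Swap f g → Swap (c ∷ f) (c ∷ g)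
  Swap-∷ c (a , b , d , e , d⊥e , refl , refl) = c ∷ a , b , d , e , d⊥e , refl , refl

  Star-Swap-∷ : (c : Cycle n) {f g : Factorization n} → Star Swap f g → Star Swap (c ∷ f) (c ∷ g)
  Star-Swap-∷ c = gmap (c ∷_) (Swap-∷ c)

  moveToFront : (f : Factorization n) (j : Fin (length f)) →
                (∀ k → k < j → Disjoint (lookup f k) (lookup f j)) → Star Swap f (lookup f j ∷ removeAt f j)
  moveToFront (c ∷ f) zero    _    = ε
  moveToFront (c ∷ f) (suc j) disj =
    Star-Swap-∷ c (moveToFront f j (λ k k<j → disj (suc k) (s≤s k<j)))
    ◅◅ ([] , removeAt f j , c , lookup f j , disj zero (s≤s z≤n) , refl , refl) ◅ ε

  Disjoint-before-to-zero : {f g : Factorization n} {d : Cycle n} (G : Reindexing f (d ∷ g)) →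
                            ∀ {j k} → to G j ≡ zero → k < j → Disjoint (lookup f k) (lookup f j)
  Disjoint-before-to-zero {f} G {j} {k} to-j≡0 k<j i with fun (lookup f k) i ≟ i | fun (lookup f j) i ≟ i
  ... | yes k-fixes | _           = inj₁ k-fixes
  ... | no _        | yes j-fixes = inj₂ j-fixes
  ... | no k-moves  | no j-moves  =
    ⊥-elim (ℕP.n≮0 (subst (to G k <_) to-j≡0 (to-mono G k<j k-moves j-moves)))

  Reindexing⇒Equivalent : (f g : Factorization n) → Reindexing f g → Equivalent f g
  Reindexing⇒Equivalent []      []      _ = [] , ε , []
  Reindexing⇒Equivalent (c ∷ f) []      G with to G zero
  ... | ()
  Reindexing⇒Equivalent f       (d ∷ g) G =
    let h , swaps , pw = Reindexing⇒Equivalent (removeAt f j) g G′ in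
    lookup f j ∷ h ,
    moveToFront f j (λ _ → Disjoint-before-to-zero G (to-from G zero)) ◅◅ Star-Swap-∷ (lookup f j) swaps ,
    (λ i → sym (lookup-from G zero i)) ∷ pw
    where
    j : Fin (length f)
    j = from G zero
    G′ : Reindexing (removeAt f j) g
    G′ = subst (λ k → Reindexing (removeAt f j) (removeAt (d ∷ g) k)) (to-from G zero) (Reindexing-removeAt G j)

-- A reindexing induces an isomorphism of maps

module ReindexingIso {n : ℕ} {f g : Factorization n} (G : Reindexing f g) where

  movers-to : ∀ i → movers g i ≡ map (to G) (movers f i)
  movers-to i = AllPairs-unique Fin.<-asym
    (movers-descending g i) mapped-descending movers⊆ ⊆movers
    where
    mapped-descending : AllPairs _>_ (map (to G) (movers f i))
    mapped-descending = AllPairs-map⁺-∈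
      (λ x∈ y∈ y<x → to-mono G y<x (∈-movers⁻ f i y∈) (∈-movers⁻ f i x∈)) (movers-descending f i)
    movers⊆ : movers g i ⊆ map (to G) (movers f i)
    movers⊆ {k} k∈ = subst (_∈ map (to G) (movers f i)) (to-from G k)
      (∈-map⁺ (to G) (∈-movers⁺ f i (Moves-from G (∈-movers⁻ g i k∈))))
    ⊆movers : map (to G) (movers f i) ⊆ movers g i
    ⊆movers k∈ with ∈-map⁻ (to G) k∈
    ... | j , j∈ , refl = ∈-movers⁺ g i (Moves-to G (∈-movers⁻ f i j∈))

  mapVtx : Vtx n (length f) → Vtx n (length g)
  mapVtx (tail i) = tail i
  mapVtx (head i) = head i
  mapVtx (int j)  = int (to G j)

  unmapVtx : Vtx n (length g) → Vtx n (length f)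
  unmapVtx (tail i) = tail i
  unmapVtx (head i) = head i
  unmapVtx (int k)  = int (from G k)

  mapVtx-int : ∀ {v k} → mapVtx v ≡ int k → v ≡ int (from G k)
  mapVtx-int {int j} refl = cong int (sym (from-to G j))

  vertexInverse : Vtx n (length f) ↔ Vtx n (length g)
  vertexInverse = mk↔ₛ′ mapVtx unmapVtx mapVtx-unmapVtx unmapVtx-mapVtx
    where
    mapVtx-unmapVtx : ∀ v → mapVtx (unmapVtx v) ≡ v
    mapVtx-unmapVtx (tail i) = refl
    mapVtx-unmapVtx (head i) = refl
    mapVtx-unmapVtx (int k)  = cong int (to-from G k)
    unmapVtx-mapVtx : ∀ v → unmapVtx (mapVtx v) ≡ v
    unmapVtx-mapVtx (tail i) = refl
    unmapVtx-mapVtx (head i) = refl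
    unmapVtx-mapVtx (int j)  = cong int (from-to G j)

  length-movers : ∀ i → length (movers f i) ≡ length (movers g i)
  length-movers i = trans (sym (length-map (to G) (movers f i))) (cong length (sym (movers-to i)))

  mapEdge : MEdge f → MEdge g
  mapEdge (i , k) = i , cast (cong suc (length-movers i)) k

  unmapEdge : MEdge g → MEdge f
  unmapEdge (i , k) = i , cast (sym (cong suc (length-movers i))) k

  edgeInverse : MEdge f ↔ MEdge g
  edgeInverse = mk↔ₛ′ mapEdge unmapEdge mapEdge-unmapEdge unmapEdge-mapEdge
    where
    mapEdge-unmapEdge : ∀ e → mapEdge (unmapEdge e) ≡ e
    mapEdge-unmapEdge (i , k) = cong (i ,_) (Fin.cast-involutive (cong suc (length-movers i)) _ k)
    unmapEdge-mapEdge : ∀ e → unmapEdge (mapEdge e) ≡ e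
    unmapEdge-mapEdge (i , k) = cong (i ,_) (Fin.cast-involutive _ (cong suc (length-movers i)) k)

  lookup-pathFrom-cast : ∀ i {l' l} → l' ≡ map (to G) l → .(eq : length l ≡ length l') → ∀ k →
                         vlookup (pathFrom g i l') (cast (cong suc eq) k) ≡ mapVtx (vlookup (pathFrom f i l) k)
  lookup-pathFrom-cast i {l = []}    refl eq zero    = refl
  lookup-pathFrom-cast i {l = x ∷ l} refl eq zero    = refl
  lookup-pathFrom-cast i {l = x ∷ l} refl eq (suc k) = lookup-pathFrom-cast i {l = l} refl (cong pred eq) k

  lookup-pathFrom-inject₁-cast : ∀ i {l' l} → l' ≡ map (to G) l → .(eq : length l ≡ length l') → ∀ k →
    vlookup (pathFrom g i l') (inject₁ (cast eq k)) ≡ mapVtx (vlookup (pathFrom f i l) (inject₁ k))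
  lookup-pathFrom-inject₁-cast i {l = x ∷ l} refl eq zero    = refl
  lookup-pathFrom-inject₁-cast i {l = x ∷ l} refl eq (suc k) =
    lookup-pathFrom-inject₁-cast i {l = l} refl (cong pred eq) k

  src-mapEdge : ∀ e → Msrc g (mapEdge e) ≡ mapVtx (Msrc f e)
  src-mapEdge (i , zero)  = refl
  src-mapEdge (i , suc k) = lookup-pathFrom-inject₁-cast i (movers-to i) (length-movers i) k

  tgt-mapEdge : ∀ e → Mtgt g (mapEdge e) ≡ mapVtx (Mtgt f e)
  tgt-mapEdge (i , k) = lookup-pathFrom-cast i (movers-to i) (length-movers i) k

  dartVertex-mapEdge : ∀ e x → Mdv g (mapEdge e , x) ≡ mapVtx (Mdv f (e , x))
  dartVertex-mapEdge e out = src-mapEdge e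
  dartVertex-mapEdge e inn = tgt-mapEdge e

  Succ-mapEdge : ∀ {e x e' x'} → MSucc f (e , x) (e' , x') → MSucc g (mapEdge e , x) (mapEdge e' , x')
  Succ-mapEdge {e} {x} {e'} {x'} (j , at-j , at-j' , turn) =
    to G j , trans (dartVertex-mapEdge e x) (cong mapVtx at-j) , trans (dartVertex-mapEdge e' x') (cong mapVtx at-j') ,
    Sum.map₂ (Product.map₂ (Product.map₂ (λ next → trans next (sym (lookup-to G j (Melab f e)))))) turn

  Succ-unmapEdge : ∀ {e x e' x'} → MSucc g (mapEdge e , x) (mapEdge e' , x') → MSucc f (e , x) (e' , x')
  Succ-unmapEdge {e} {x} {e'} {x'} (k , at-k , at-k' , turn) =
    from G k , mapVtx-int (trans (sym (dartVertex-mapEdge e x)) at-k) ,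
    mapVtx-int (trans (sym (dartVertex-mapEdge e' x')) at-k') ,
    Sum.map₂ (Product.map₂ (Product.map₂ (λ next → trans next (lookup-from G k (Melab f e))))) turn

  iso : 𝓜 f ≅ 𝓜 g
  iso = record
    { φV        = vertexInverse
    ; φE        = edgeInverse
    ; src-pres  = src-mapEdge
    ; tgt-pres  = tgt-mapEdge
    ; vlab-pres = λ { (tail _) → refl ; (head _) → refl ; (int _) → refl }
    ; elab-pres = λ _ → refl
    ; rot-pres  = λ _ _ → mk⇔ Succ-mapEdge Succ-unmapEdge
    }

Reindexing⇒≅ : ∀ {n} {f g : Factorization n} → Reindexing f g → 𝓜 f ≅ 𝓜 g
Reindexing⇒≅ = ReindexingIso.iso

-- An isomorphism of maps induces a reindexing

module IsoReindexing {n : ℕ} {f g : Factorization n} (I : 𝓜 f ≅ 𝓜 g) where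
  open _≅_ I

  ψv : Vtx n (length g) → Vtx n (length f)
  ψv = Inverse.from φV

  ψe : MEdge g → MEdge f
  ψe = Inverse.from φE

  π : Fin (length f) → Fin (length g)
  π j = proj₁ (unlabelled⇒int g (φv (int j)) (vlab-pres (int j)))

  φv-int : ∀ j → φv (int j) ≡ int (π j)
  φv-int j = proj₂ (unlabelled⇒int g (φv (int j)) (vlab-pres (int j)))

  ψv-unlabelled : ∀ k → Mvlab f (ψv (int k)) ≡ nothing
  ψv-unlabelled k = trans (sym (vlab-pres (ψv (int k)))) (cong (Mvlab g) (Inverse.strictlyInverseˡ φV (int k)))

  ρ : Fin (length g) → Fin (length f)
  ρ k = proj₁ (unlabelled⇒int f (ψv (int k)) (ψv-unlabelled k))

  ψv-int : ∀ k → ψv (int k) ≡ int (ρ k)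
  ψv-int k = proj₂ (unlabelled⇒int f (ψv (int k)) (ψv-unlabelled k))

  π-ρ : ∀ k → π (ρ k) ≡ k
  π-ρ k = int-injective (begin
    int (π (ρ k))   ≡⟨ sym (φv-int (ρ k)) ⟩
    φv (int (ρ k))  ≡⟨ cong φv (sym (ψv-int k)) ⟩
    φv (ψv (int k)) ≡⟨ Inverse.strictlyInverseˡ φV (int k) ⟩
    int k           ∎)
    where open ≡-Reasoning

  ρ-π : ∀ j → ρ (π j) ≡ j
  ρ-π j = int-injective (begin
    int (ρ (π j))   ≡⟨ sym (ψv-int (π j)) ⟩
    ψv (int (π j))  ≡⟨ cong ψv (sym (φv-int j)) ⟩
    ψv (φv (int j)) ≡⟨ Inverse.strictlyInverseʳ φV (int j) ⟩
    int j           ∎)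
    where open ≡-Reasoning

  InEdge-ρ : ∀ {k i} → InEdge g k i → InEdge f (ρ k) i
  InEdge-ρ {k} {i} (e , labelled , at-k) = ψe e , labelled′ , at-ρk
    where
    φψe : φe (ψe e) ≡ e
    φψe = Inverse.strictlyInverseˡ φE e
    labelled′ : Melab f (ψe e) ≡ i
    labelled′ = trans (sym (elab-pres (ψe e))) (trans (cong (Melab g) φψe) labelled)
    at-ρk : Mtgt f (ψe e) ≡ int (ρ k)
    at-ρk = begin
      Mtgt f (ψe e)           ≡⟨ sym (Inverse.strictlyInverseʳ φV _) ⟩
      ψv (φv (Mtgt f (ψe e))) ≡⟨ cong ψv (sym (tgt-pres (ψe e))) ⟩
      ψv (Mtgt g (φe (ψe e))) ≡⟨ cong (ψv ∘ Mtgt g) φψe ⟩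
      ψv (Mtgt g e)           ≡⟨ cong ψv at-k ⟩
      ψv (int k)              ≡⟨ ψv-int k ⟩
      int (ρ k)               ∎
      where open ≡-Reasoning

  lookup-π-moved : ∀ {j i} → Moves (lookup f j) i → fun (lookup g (π j)) i ≡ fun (lookup f j) i
  lookup-π-moved {j} {i} moves
    with e , refl , at-j ← Moves⇒InEdge f moves
       | e' , next-i , from-j ← Moves⇒OutEdge f (moves ∘ inj (lookup f j))
    -- the first alternative of MSucc would need inn ≡ out
    with k , at-k , _ , inj₂ (_ , _ , next) ←
         Equivalence.to (rot-pres (e , inn) (e' , out)) (j , at-j , from-j , inj₂ (refl , refl , next-i))
    = begin
      fun (lookup g (π j)) i               ≡⟨ cong (λ k′ → fun (lookup g k′) i) π-j≡k ⟩
      fun (lookup g k) i                   ≡⟨ cong (fun (lookup g k)) (sym (elab-pres e)) ⟩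
      fun (lookup g k) (Melab g (φe e))    ≡⟨ sym next ⟩
      Melab g (φe e')                      ≡⟨ elab-pres e' ⟩
      Melab f e'                           ≡⟨ next-i ⟩
      fun (lookup f j) i                   ∎
    where
    open ≡-Reasoning
    π-j≡k : π j ≡ k
    π-j≡k = int-injective (trans (sym (φv-int j)) (trans (cong φv (sym at-j)) (trans (sym (tgt-pres e)) at-k)))

  lookup-π : ∀ j → lookup g (π j) ≈ᶜ lookup f j
  lookup-π j i with fun (lookup f j) i ≟ i | fun (lookup g (π j)) i ≟ i
  ... | no moves   | _          = lookup-π-moved moves
  ... | yes fixes  | yes fixes′ = trans fixes′ (sym fixes)
  ... | yes fixes  | no moves′  =
    ⊥-elim (InEdge⇒Moves f (subst (λ j′ → InEdge f j′ i) (ρ-π j) (InEdge-ρ (Moves⇒InEdge g moves′)))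
                         fixes)

  π-mono : ∀ {i j j'} → j < j' → Moves (lookup f j) i → Moves (lookup f j') i → π j < π j'
  π-mono {i} {j} {j'} j<j' moves moves′ =
    ℕ.s<s⁻¹ (subst₂ (λ u v → rank u ℕ.< rank v) (φv-int j) (φv-int j') image-descends)
    where
    _↘_ : Vtx n (length f) → Vtx n (length f) → Set
    u ↘ v = rank (φv v) ℕ.< rank (φv u)
    edge-descends : ∀ e → Msrc f e ↘ Mtgt f e
    edge-descends e = subst₂ (λ u v → rank u ℕ.< rank v) (tgt-pres e) (src-pres e) (rank-decreases g (φe e))
    image-descends : int j' ↘ int j
    image-descends = pathFrom-chain f i {R = _↘_} (λ u↘v v↘w → ℕP.<-trans v↘w u↘v) (movers-descending f i)
      (λ k → edge-descends (i , suc k)) (∈-movers⁺ f i moves′) (∈-movers⁺ f i moves) j<j'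

  reindexing : Reindexing f g
  reindexing = record
    { to = π ; from = ρ ; to-from = π-ρ ; from-to = ρ-π ; lookup-to = lookup-π ; to-mono = π-mono }

≅⇒Reindexing : ∀ {n} {f g : Factorization n} → 𝓜 f ≅ 𝓜 g → Reindexing f g
≅⇒Reindexing = IsoReindexing.reindexing

lemma4p1 : ∀ {n : ℕ} (f f' : Factorization n) → (𝓜 f ≅ 𝓜 f') ⇔ Equivalent f f'
lemma4p1 f f' = mk⇔ (Reindexing⇒Equivalent f f' ∘ ≅⇒Reindexing) (Reindexing⇒≅ ∘ Equivalent⇒Reindexing)
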